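{- For every positive integer $n$, \[ \mathrm{Comp}_{n+1}(A_n) = (S_{\Omega_{n+1}} \cap A_{n+1}) \cup (X_{n+1} \cap (S_{n+1}\setminus A_{n+1})). \]
   Context: $S_n$ is the symmetric group on $[n]=\{1,\dots,n\}$ and $A_n$ the alternating group. $\Omega_{n}$ denotes the partition of $[n]$ into the set of odd numbers and the set of even numbers; $S_{\Omega_n}$ is the set of $\pi\in S_n$ mapping each block of $\Omega_n$ onto itself (i.e. $\pi(i)\equiv i \pmod 2$ for all $i$), and $X_n$ is the set of $\pi\in S_n$ interchanging the two blocks, i.e. $\pi(i)$ is odd iff $i$ is even, for all $i\in[n]$ (empty if $n$ is odd). A permutation $\pi\in S_m$ involves $\tau\in S_n$ ($n\le m$) if there are indices $i_1<\dots<i_n$ with $\pi(i_j)<\pi(i_k)$ iff $\tau(j)<\tau(k)$ for all $j,k$; such $\tau$ is an $n$-pattern of $\pi$. For $S\subseteq S_n$, $\mathrm{Comp}_m(S)$ is the set of all $\tau\in S_m$ all of whose $n$-patterns belong to $S$. -}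

module Defs where

open import Data.Nat using (ℕ; zero; suc; _%_)
open import Data.Fin using (Fin; toℕ; _<_; _<?_)
open import Data.Fin.Permutation using (Permutation′; _⟨$⟩ʳ_)
open import Data.List using (List; length; filter; allFin; concatMap; map)
open import Data.Product using (_×_; _,_; proj₁; proj₂)
open import Relation.Nullary.Decidable using (_×-dec_)
open import Relation.Binary.PropositionalEquality using (_≡_; _≢_)
open import Function.Bundles using (_⇔_)
open import Data.Sum using (_⊎_)

pairs : (n : ℕ) → List (Fin n × Fin n)
pairs n = concatMap (λ i → map (λ j → (i , j)) (allFin n)) (allFin n)

inversions : {n : ℕ} → Permutation′ n → ℕ
inversions {n} π =
  length (filter (λ p → (proj₁ p <? proj₂ p) ×-dec ((π ⟨$⟩ʳ proj₂ p) <? (π ⟨$⟩ʳ proj₁ p))) (pairs n))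

-- π is even (π ∈ A_n) iff it has an even number of inversions.
IsEven : {n : ℕ} → Permutation′ n → Set
IsEven π = inversions π % 2 ≡ 0

-- Parity of the element i+1 of [n] represented by i : Fin n (Fin is 0-based).
par : {n : ℕ} → Fin n → ℕ
par i = suc (toℕ i) % 2

InSOmega : {n : ℕ} → Permutation′ n → Set
InSOmega {n} π = (i : Fin n) → par (π ⟨$⟩ʳ i) ≡ par i

InX : {n : ℕ} → Permutation′ n → Set
InX {n} π = (i : Fin n) → par (π ⟨$⟩ʳ i) ≢ par i

StrictlyIncreasing : {n m : ℕ} → (Fin n → Fin m) → Set
StrictlyIncreasing {n} f = (j k : Fin n) → j < k → f j < f k

IsPatternAt : {n m : ℕ} → Permutation′ m → (Fin n → Fin m) → Permutation′ n → Set
IsPatternAt {n} τ f σ =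
  (j k : Fin n) → ((σ ⟨$⟩ʳ j) < (σ ⟨$⟩ʳ k)) ⇔ ((τ ⟨$⟩ʳ f j) < (τ ⟨$⟩ʳ f k))

Comp : {n : ℕ} (m : ℕ) → (Permutation′ n → Set) → Permutation′ m → Set
Comp {n} m S τ =
  (f : Fin n → Fin m) → StrictlyIncreasing f →
  (σ : Permutation′ n) → IsPatternAt τ f σ → S σ

-- Deleting the entry at position p of τ ∈ S(n+1) yields its n-pattern at the
-- remaining positions, and every n-pattern of τ arises this way. The deleted
-- inversions are those involving p; if b entries left of p are smaller than
-- τ(p), there are p − b of them to the left of p and τ(p) − b to its right,
-- so inv τ ≡ inv (τ without p) + p + τ(p) (mod 2). Hence τ ∈ Comp(A n) iff
-- inv τ ≡ p + τ(p) (mod 2) for every p: for even τ this says that τ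
-- preserves parities, for odd τ that it swaps them.

module Submission where

open import Defs
open import Data.Nat using (ℕ; suc; _≤_)
open import Data.Fin.Permutation using (Permutation′)
open import Data.Product using (_×_)
open import Data.Sum using (_⊎_)
open import Relation.Nullary using (¬_)
open import Function.Bundles using (_⇔_)

open import Data.Nat using (zero; _+_; _%_; z<s; s<s; s<s⁻¹; parity)
import Data.Nat.Properties as ℕ
open import Data.Fin using (Fin; toℕ; punchIn; punchOut; _<_; _<?_; _≟_) renaming (zero to 0F; suc to sucF)
open import Data.Fin.Properties using (<-cmp; <-irrefl; <-asym; <⇒≢; <⇒notInjective; punchIn-punchOut)
open import Data.Fin.Permutation using (_⟨$⟩ʳ_; _⟨$⟩ˡ_; remove; inverseˡ; punchIn-permute)
open import Data.Parity.Base as ℙ using (Parity; 0ℙ; 1ℙ; _⁻¹)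
open import Data.Parity.Properties as ℙ using (+-homo-+; suc-homo-⁻¹; ⁻¹-injective; p+p≡0ℙ)
open import Data.List using (List; _++_; length; filter; concatMap; map; tabulate)
open import Data.List.Properties using (length-++; filter-++; map-tabulate)
open import Data.Product using (∃; _,_; proj₁; proj₂)
open import Data.Sum using (inj₁; inj₂; [_,_]) renaming (map to ⊎-map)
open import Data.Nat.Tactic.RingSolver using (solve-∀)
open import Data.Bool using (if_then_else_)
open import Data.Empty using (⊥-elim)
open import Relation.Nullary using (Dec; yes; no; does; contradiction)
open import Relation.Nullary.Decidable using (_×-dec_)
open import Relation.Unary using (Pred; Decidable)
open import Relation.Binary using (tri<; tri≈; tri>)
open import Relation.Binary.PropositionalEquality
  using (_≡_; _≢_; refl; sym; trans; cong; cong₂; subst; subst₂; _≗_; module ≡-Reasoning)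
open import Function using (_∘_; id)
open import Function.Definitions using (Injective)
open import Function.Bundles using (mk⇔; Equivalence)
open import Function.Properties.Equivalence using () renaming (trans to ⇔-trans; sym to ⇔-sym)
open import Function.Related.Propositional using (module EquationalReasoning)
open import Function.Related.TypeIsomorphisms using (¬-cong-⇔)
open import Data.Product.Function.NonDependent.Propositional using (_×-⇔_)
open import Data.Sum.Function.Propositional using (_⊎-⇔_)
open import Level using (Level)
open import Algebra.Properties.CommutativeMonoid.Sum ℕ.+-0-commutativeMonoid
  using (sum-syntax; sum-cong-≗; sum-remove; sum-permute; ∑-distrib-+; sum-replicate-zero)

private
  variable
    a : Level
    A B C : Set a
    m n : ℕ

Π-cong-⇔ : {b c : Level} {I : Set a} {P : I → Set b} {Q : I → Set c} →
  (∀ i → P i ⇔ Q i) → (∀ i → P i) ⇔ (∀ i → Q i)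
Π-cong-⇔ P⇔Q = mk⇔ (λ p i → Equivalence.to (P⇔Q i) (p i)) (λ q i → Equivalence.from (P⇔Q i) (q i))

parityToℕ : Parity → ℕ
parityToℕ 0ℙ = 0
parityToℕ 1ℙ = 1

%2≡parityToℕ : ∀ k → k % 2 ≡ parityToℕ (parity k)
%2≡parityToℕ 0             = refl
%2≡parityToℕ 1             = refl
%2≡parityToℕ (suc (suc k)) = %2≡parityToℕ k

parityToℕ-injective : Injective _≡_ _≡_ parityToℕ
parityToℕ-injective {0ℙ} {0ℙ} _ = refl
parityToℕ-injective {1ℙ} {1ℙ} _ = refl

%2-≡⇔parity-≡ : ∀ k l → (k % 2 ≡ l % 2) ⇔ (parity k ≡ parity l)
%2-≡⇔parity-≡ k l = mk⇔
  (λ eq → parityToℕ-injective (trans (sym (%2≡parityToℕ k)) (trans eq (%2≡parityToℕ l))))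
  (λ eq → trans (%2≡parityToℕ k) (trans (cong parityToℕ eq) (sym (%2≡parityToℕ l))))

+≡0ℙ⇔≡ : (x y : Parity) → (x ℙ.+ y ≡ 0ℙ) ⇔ (x ≡ y)
+≡0ℙ⇔≡ 0ℙ 0ℙ = mk⇔ (λ _ → refl) (λ _ → refl)
+≡0ℙ⇔≡ 0ℙ 1ℙ = mk⇔ (λ ()) (λ ())
+≡0ℙ⇔≡ 1ℙ 0ℙ = mk⇔ (λ ()) (λ ())
+≡0ℙ⇔≡ 1ℙ 1ℙ = mk⇔ (λ _ → refl) (λ _ → refl)

+≡1ℙ⇔≢ : (x y : Parity) → (x ℙ.+ y ≡ 1ℙ) ⇔ (x ≢ y)
+≡1ℙ⇔≢ 0ℙ 0ℙ = mk⇔ (λ ()) (λ ne → contradiction refl ne)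
+≡1ℙ⇔≢ 0ℙ 1ℙ = mk⇔ (λ _ ()) (λ _ → refl)
+≡1ℙ⇔≢ 1ℙ 0ℙ = mk⇔ (λ _ ()) (λ _ → refl)
+≡1ℙ⇔≢ 1ℙ 1ℙ = mk⇔ (λ ()) (λ ne → contradiction refl ne)

≡+⇒≡0ℙ⇔≡ : {x y z : Parity} → x ≡ y ℙ.+ z → (y ≡ 0ℙ) ⇔ (x ≡ z)
≡+⇒≡0ℙ⇔≡ {y = 0ℙ}     x≡z  = mk⇔ (λ _ → x≡z) (λ _ → refl)
≡+⇒≡0ℙ⇔≡ {y = 1ℙ} {z} x≡z⁻¹ =
  mk⇔ (λ ()) (λ x≡z → contradiction (trans (sym x≡z) x≡z⁻¹) (ℙ.p≢p⁻¹ z))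

all-≡⇔constant : (e : Parity) (d : Fin n → Parity) →
  (∀ i → e ≡ d i) ⇔ (((∀ i → d i ≡ 0ℙ) × e ≡ 0ℙ) ⊎ ((∀ i → d i ≡ 1ℙ) × e ≢ 0ℙ))
all-≡⇔constant 0ℙ d = mk⇔ (λ 0≡d → inj₁ (sym ∘ 0≡d , refl))
  [ (λ (d≡0 , _) → sym ∘ d≡0) , (λ (_ , 0≢0) → contradiction refl 0≢0) ]
all-≡⇔constant 1ℙ d = mk⇔ (λ 1≡d → inj₂ (sym ∘ 1≡d , λ ()))
  [ (λ { (_ , ()) }) , (λ (d≡1 , _) → sym ∘ d≡1) ]

-- Defined through `does` so that it computes through _×-dec_ and map′:
-- this is what makes ∑-𝟙-< hold by unfolding.
𝟙 : Dec A → ℕ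
𝟙 a? = if does a? then 1 else 0

𝟙-yes : A → (a? : Dec A) → 𝟙 a? ≡ 1
𝟙-yes x (yes _) = refl
𝟙-yes x (no ¬x) = contradiction x ¬x

𝟙-no : ¬ A → (a? : Dec A) → 𝟙 a? ≡ 0
𝟙-no ¬x (yes x) = contradiction x ¬x
𝟙-no ¬x (no _)  = refl

𝟙-cong : (a? : Dec A) (b? : Dec B) → (A → B) → (B → A) → 𝟙 a? ≡ 𝟙 b?
𝟙-cong (yes x) b? f g = sym (𝟙-yes (f x) b?)
𝟙-cong (no ¬x) b? f g = sym (𝟙-no (¬x ∘ g) b?)

𝟙-partition : (a? : Dec A) (b? : Dec B) (c? : Dec C) →
  (B → A) → (C → A) → (A → B ⊎ C) → (B → ¬ C) → 𝟙 b? + 𝟙 c? ≡ 𝟙 a?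
𝟙-partition a? (yes b) c? b⇒a c⇒a a⇒b⊎c b⇒¬c
  rewrite 𝟙-no (b⇒¬c b) c? | 𝟙-yes (b⇒a b) a? = refl
𝟙-partition a? (no ¬b) (yes c) b⇒a c⇒a a⇒b⊎c b⇒¬c
  rewrite 𝟙-yes (c⇒a c) a? = refl
𝟙-partition a? (no ¬b) (no ¬c) b⇒a c⇒a a⇒b⊎c b⇒¬c
  rewrite 𝟙-no ([ ¬b , ¬c ] ∘ a⇒b⊎c) a? = refl

∑-𝟙-< : (p : Fin n) → ∑[ i < n ] 𝟙 (i <? p) ≡ toℕ p
∑-𝟙-< {suc n} 0F = sum-replicate-zero n
∑-𝟙-< {suc n} (sucF p) = cong suc (∑-𝟙-< p)

length-filter-tabulate : {P : Pred A a} (P? : Decidable P) (f : Fin n → A) →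
  length (filter P? (tabulate f)) ≡ ∑[ i < n ] 𝟙 (P? (f i))
length-filter-tabulate {n = zero}  P? f = refl
length-filter-tabulate {n = suc n} P? f with P? (f 0F)
... | yes _ = cong suc (length-filter-tabulate P? (f ∘ sucF))
... | no _  = length-filter-tabulate P? (f ∘ sucF)

length-filter-concatMap : {P : Pred A a} (P? : Decidable P) (g : B → List A) (f : Fin n → B) →
  length (filter P? (concatMap g (tabulate f))) ≡ ∑[ i < n ] length (filter P? (g (f i)))
length-filter-concatMap {n = zero}  P? g f = refl
length-filter-concatMap {n = suc n} P? g f = begin
  length (filter P? (g (f 0F) ++ rest))            ≡⟨ cong length (filter-++ P? (g (f 0F)) rest) ⟩
  length (filter P? (g (f 0F)) ++ filter P? rest)  ≡⟨ length-++ (filter P? (g (f 0F))) ⟩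
  length (filter P? (g (f 0F))) + length (filter P? rest)
    ≡⟨ cong (length (filter P? (g (f 0F))) +_) (length-filter-concatMap P? g (f ∘ sucF)) ⟩
  length (filter P? (g (f 0F))) + ∑[ i < n ] length (filter P? (g (f (sucF i)))) ∎
  where
  open ≡-Reasoning
  rest = concatMap g (tabulate (f ∘ sucF))

Inverted : Permutation′ n → Fin n → Fin n → Set
Inverted π i j = i < j × π ⟨$⟩ʳ j < π ⟨$⟩ʳ i

inverted? : (π : Permutation′ n) (i j : Fin n) → Dec (Inverted π i j)
inverted? π i j = (i <? j) ×-dec ((π ⟨$⟩ʳ j) <? (π ⟨$⟩ʳ i))

inversions-∑ : (π : Permutation′ n) → inversions π ≡ ∑[ i < n ] ∑[ j < n ] 𝟙 (inverted? π i j)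
inversions-∑ {n} π = begin
  inversions π
    ≡⟨ length-filter-concatMap inverted?′ (λ i → map (i ,_) (tabulate id)) id ⟩
  ∑[ i < n ] length (filter inverted?′ (map (i ,_) (tabulate id)))
    ≡⟨ sum-cong-≗ (λ i → cong (length ∘ filter inverted?′) (map-tabulate id (i ,_))) ⟩
  ∑[ i < n ] length (filter inverted?′ (tabulate (i ,_)))
    ≡⟨ sum-cong-≗ (λ i → length-filter-tabulate inverted?′ (i ,_)) ⟩
  ∑[ i < n ] ∑[ j < n ] 𝟙 (inverted? π i j) ∎
  where
  open ≡-Reasoning
  inverted?′ : Decidable (λ (ij : Fin n × Fin n) → Inverted π (proj₁ ij) (proj₂ ij))
  inverted?′ (i , j) = inverted? π i j

≢⇒<⊎> : {i j : Fin n} → i ≢ j → i < j ⊎ j < i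
≢⇒<⊎> {i = i} {j} i≢j with <-cmp i j
... | tri< i<j _ _ = inj₁ i<j
... | tri≈ _ i≡j _ = contradiction i≡j i≢j
... | tri> _ _ j<i = inj₂ j<i

module _ {f : Fin m → Fin n} (f↑ : StrictlyIncreasing f) where

  increasing⇒injective : Injective _≡_ _≡_ f
  increasing⇒injective {i} {j} fi≡fj with <-cmp i j
  ... | tri< i<j _ _ = contradiction fi≡fj (<⇒≢ (f↑ i j i<j))
  ... | tri≈ _ i≡j _ = i≡j
  ... | tri> _ _ j<i = contradiction (sym fi≡fj) (<⇒≢ (f↑ j i j<i))

  increasing-cancel-< : ∀ {i j} → f i < f j → i < j
  increasing-cancel-< {i} {j} fi<fj with <-cmp i j
  ... | tri< i<j _ _    = i<j
  ... | tri≈ _ refl _   = contradiction fi<fj (<-irrefl refl)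
  ... | tri> _ _ j<i    = contradiction (f↑ j i j<i) (<-asym fi<fj)

punchIn-increasing : (p : Fin (suc n)) → StrictlyIncreasing (punchIn p)
punchIn-increasing 0F       i        j        i<j = s<s i<j
punchIn-increasing (sucF p) 0F       (sucF j) _   = z<s
punchIn-increasing (sucF p) (sucF i) (sucF j) i<j = s<s (punchIn-increasing p i j (s<s⁻¹ i<j))

module _ {f : Fin m → Fin (suc n)} (f≢0 : ∀ i → f i ≢ 0F) where

  pred∘ : Fin m → Fin n
  pred∘ i = punchOut (f≢0 i ∘ sym)

  suc∘pred∘ : ∀ i → sucF (pred∘ i) ≡ f i
  suc∘pred∘ i = punchIn-punchOut (f≢0 i ∘ sym)

  pred∘-increasing : StrictlyIncreasing f → StrictlyIncreasing pred∘
  pred∘-increasing f↑ i j i<j =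
    s<s⁻¹ (subst₂ _<_ (sym (suc∘pred∘ i)) (sym (suc∘pred∘ j)) (f↑ i j i<j))

module _ {f : Fin (suc m) → Fin (suc n)} (f↑ : StrictlyIncreasing f) where

  increasing-suc≢0 : ∀ i → f (sucF i) ≢ 0F
  increasing-suc≢0 i f[1+i]≡0 with subst (f 0F <_) f[1+i]≡0 (f↑ 0F (sucF i) z<s)
  ... | ()

  increasing-≢0 : f 0F ≢ 0F → ∀ i → f i ≢ 0F
  increasing-≢0 f0≢0 0F       = f0≢0
  increasing-≢0 f0≢0 (sucF i) = increasing-suc≢0 i

  increasing-tail : StrictlyIncreasing (pred∘ increasing-suc≢0)
  increasing-tail = pred∘-increasing increasing-suc≢0 (λ i j i<j → f↑ (sucF i) (sucF j) (s<s i<j))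

increasing-0 : (g : Fin (suc n) → Fin (suc n)) → StrictlyIncreasing g → g 0F ≡ 0F
increasing-0 g g↑ with g 0F ≟ 0F
... | yes g0≡0 = g0≡0
... | no  g0≢0 =
  ⊥-elim (<⇒notInjective (ℕ.n<1+n _) (increasing⇒injective (pred∘-increasing g≢0 g↑)))
  where g≢0 = increasing-≢0 g↑ g0≢0

increasing-id : (g : Fin n → Fin n) → StrictlyIncreasing g → g ≗ id
increasing-id g g↑ 0F       = increasing-0 g g↑
increasing-id g g↑ (sucF i) = begin
  g (sucF i)                           ≡⟨ suc∘pred∘ (increasing-suc≢0 g↑) i ⟨
  sucF (pred∘ (increasing-suc≢0 g↑) i) ≡⟨ cong sucF (increasing-id _ (increasing-tail g↑) i) ⟩
  sucF i                               ∎
  where open ≡-Reasoning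

increasing-punchIn : (f : Fin n → Fin (suc n)) → StrictlyIncreasing f → ∃ λ p → f ≗ punchIn p
increasing-punchIn {zero}  f f↑ = 0F , λ ()
increasing-punchIn {suc n} f f↑ with f 0F ≟ 0F
... | no f0≢0 = 0F , λ i → trans (sym (suc∘pred∘ f≢0 i))
                          (cong sucF (increasing-id (pred∘ f≢0) (pred∘-increasing f≢0 f↑) i))
  where f≢0 = increasing-≢0 f↑ f0≢0
... | yes f0≡0 with increasing-punchIn _ (increasing-tail f↑)
...   | p , tail≗punchIn = sucF p , λ where
  0F       → f0≡0
  (sucF i) → trans (sym (suc∘pred∘ (increasing-suc≢0 f↑) i)) (cong sucF (tail≗punchIn i))

module _ (τ : Permutation′ m) where

  patternAt-cong : {f g : Fin n → Fin m} (σ : Permutation′ n) →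
    f ≗ g → IsPatternAt τ f σ → IsPatternAt τ g σ
  patternAt-cong σ f≗g pat j k rewrite sym (f≗g j) | sym (f≗g k) = pat j k

  patternAt-inversions : (f : Fin n → Fin m) (σ : Permutation′ n) →
    StrictlyIncreasing f → IsPatternAt τ f σ →
    inversions σ ≡ ∑[ j < n ] ∑[ k < n ] 𝟙 (inverted? τ (f j) (f k))
  patternAt-inversions f σ f↑ pat = trans (inversions-∑ σ) (sum-cong-≗ λ j → sum-cong-≗ λ k →
    𝟙-cong (inverted? σ j k) (inverted? τ (f j) (f k))
      (λ (j<k , σk<σj) → f↑ j k j<k , Equivalence.to (pat k j) σk<σj)
      (λ (fj<fk , τfk<τfj) → increasing-cancel-< f↑ fj<fk , Equivalence.from (pat k j) τfk<τfj))

  patternAt-inversions-unique : (f : Fin n → Fin m) (σ σ′ : Permutation′ n) →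
    StrictlyIncreasing f → IsPatternAt τ f σ → IsPatternAt τ f σ′ → inversions σ ≡ inversions σ′
  patternAt-inversions-unique f σ σ′ f↑ pat pat′ =
    trans (patternAt-inversions f σ f↑ pat) (sym (patternAt-inversions f σ′ f↑ pat′))

remove-patternAt : (τ : Permutation′ (suc n)) (p : Fin (suc n)) → IsPatternAt τ (punchIn p) (remove p τ)
remove-patternAt τ p j k = mk⇔
  (λ σj<σk → subst₂ _<_ (sym (punchIn-permute τ p j)) (sym (punchIn-permute τ p k))
               (punchIn-increasing (τ ⟨$⟩ʳ p) _ _ σj<σk))
  (λ τj<τk → increasing-cancel-< (punchIn-increasing (τ ⟨$⟩ʳ p))
               (subst₂ _<_ (punchIn-permute τ p j) (punchIn-permute τ p k) τj<τk))

Comp-IsEven⇔removals-even : (τ : Permutation′ (suc n)) →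
  Comp {n} (suc n) IsEven τ ⇔ (∀ p → IsEven (remove p τ))
Comp-IsEven⇔removals-even {n} τ = mk⇔
  (λ comp p → comp (punchIn p) (punchIn-increasing p) (remove p τ) (remove-patternAt τ p))
  patterns-even
  where
  patterns-even : (∀ p → IsEven (remove p τ)) → Comp {n} (suc n) IsEven τ
  patterns-even removals-even f f↑ σ pat with increasing-punchIn f f↑
  ... | p , f≗punchIn = subst (λ k → k % 2 ≡ 0)
    (patternAt-inversions-unique τ (punchIn p) (remove p τ) σ (punchIn-increasing p)
      (remove-patternAt τ p) (patternAt-cong τ σ f≗punchIn pat))
    (removals-even p)

permute-injective : (π : Permutation′ n) → Injective _≡_ _≡_ (π ⟨$⟩ʳ_)
permute-injective π πi≡πj = trans (sym (inverseˡ π)) (trans (cong (π ⟨$⟩ˡ_) πi≡πj) (inverseˡ π))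

displacement : Permutation′ n → Fin n → Parity
displacement τ i = parity (toℕ (τ ⟨$⟩ʳ i)) ℙ.+ parity (toℕ i)

module _ (τ : Permutation′ (suc n)) (p : Fin (suc n)) where
  private
    I : Fin (suc n) → Fin (suc n) → ℕ
    I i j = 𝟙 (inverted? τ i j)

    smallerLeft? : (i : Fin (suc n)) → Dec (i < p × τ ⟨$⟩ʳ i < τ ⟨$⟩ʳ p)
    smallerLeft? i = (i <? p) ×-dec ((τ ⟨$⟩ʳ i) <? (τ ⟨$⟩ʳ p))

    inversionsWithLeft inversionsWithRight smallerLeft : ℕ
    inversionsWithLeft  = ∑[ i < suc n ] I i p
    inversionsWithRight = ∑[ j < suc n ] I p j
    smallerLeft = ∑[ i < suc n ] 𝟙 (smallerLeft? i)

    inversionsAvoiding : ℕ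
    inversionsAvoiding = ∑[ j < n ] ∑[ k < n ] I (punchIn p j) (punchIn p k)

  open ≡-Reasoning

  private
    inversionsWithLeft-punchIn : inversionsWithLeft ≡ ∑[ j < n ] I (punchIn p j) p
    inversionsWithLeft-punchIn = begin
      inversionsWithLeft
        ≡⟨ sum-remove (λ i → I i p) ⟩
      I p p + ∑[ j < n ] I (punchIn p j) p
        ≡⟨ cong (_+ ∑[ j < n ] I (punchIn p j) p) (𝟙-no (<-irrefl refl ∘ proj₁) (inverted? τ p p)) ⟩
      ∑[ j < n ] I (punchIn p j) p ∎

    inversions-split : inversions τ ≡ inversionsWithRight + (inversionsWithLeft + inversionsAvoiding)
    inversions-split = begin
      inversions τ
        ≡⟨ inversions-∑ τ ⟩
      ∑[ i < suc n ] ∑[ j < suc n ] I i j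
        ≡⟨ sum-remove (λ i → ∑[ j < suc n ] I i j) ⟩
      inversionsWithRight + ∑[ j < n ] ∑[ k < suc n ] I (punchIn p j) k
        ≡⟨ cong (inversionsWithRight +_) (sum-cong-≗ λ j → sum-remove (I (punchIn p j))) ⟩
      inversionsWithRight + ∑[ j < n ] (I (punchIn p j) p + ∑[ k < n ] I (punchIn p j) (punchIn p k))
        ≡⟨ cong (inversionsWithRight +_) (∑-distrib-+ (λ j → I (punchIn p j) p) _) ⟩
      inversionsWithRight + (∑[ j < n ] I (punchIn p j) p + inversionsAvoiding)
        ≡⟨ cong (λ x → inversionsWithRight + (x + inversionsAvoiding)) inversionsWithLeft-punchIn ⟨
      inversionsWithRight + (inversionsWithLeft + inversionsAvoiding) ∎

    inversionsAvoiding≡inversions-remove : inversionsAvoiding ≡ inversions (remove p τ)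
    inversionsAvoiding≡inversions-remove =
      sym (patternAt-inversions τ (punchIn p) (remove p τ) (punchIn-increasing p) (remove-patternAt τ p))
    inversionsWithLeft+smallerLeft : inversionsWithLeft + smallerLeft ≡ toℕ p
    inversionsWithLeft+smallerLeft = begin
      inversionsWithLeft + smallerLeft
        ≡⟨ ∑-distrib-+ (λ i → I i p) (𝟙 ∘ smallerLeft?) ⟨
      ∑[ i < suc n ] (I i p + 𝟙 (smallerLeft? i))
        ≡⟨ sum-cong-≗ (λ i → 𝟙-partition (i <? p) (inverted? τ i p) (smallerLeft? i) proj₁ proj₁
             (λ i<p → ⊎-map (i<p ,_) (i<p ,_)
               (≢⇒<⊎> (<⇒≢ i<p ∘ permute-injective τ ∘ sym)))
             (λ (_ , τp<τi) (_ , τi<τp) → <-asym τp<τi τi<τp)) ⟩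
      ∑[ i < suc n ] 𝟙 (i <? p)
        ≡⟨ ∑-𝟙-< p ⟩
      toℕ p ∎

    inversionsWithRight+smallerLeft : inversionsWithRight + smallerLeft ≡ toℕ (τ ⟨$⟩ʳ p)
    inversionsWithRight+smallerLeft = begin
      inversionsWithRight + smallerLeft
        ≡⟨ ∑-distrib-+ (I p) (𝟙 ∘ smallerLeft?) ⟨
      ∑[ j < suc n ] (I p j + 𝟙 (smallerLeft? j))
        ≡⟨ sum-cong-≗ (λ j → 𝟙-partition ((τ ⟨$⟩ʳ j) <? (τ ⟨$⟩ʳ p)) (inverted? τ p j) (smallerLeft? j)
             proj₂ proj₂
             (λ τj<τp → ⊎-map (_, τj<τp) (_, τj<τp)
               (≢⇒<⊎> (<⇒≢ τj<τp ∘ cong (τ ⟨$⟩ʳ_) ∘ sym)))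
             (λ (p<j , _) (j<p , _) → <-asym p<j j<p)) ⟩
      ∑[ j < suc n ] 𝟙 ((τ ⟨$⟩ʳ j) <? (τ ⟨$⟩ʳ p))
        ≡⟨ sum-permute (λ v → 𝟙 (v <? (τ ⟨$⟩ʳ p))) τ ⟨
      ∑[ v < suc n ] 𝟙 (v <? (τ ⟨$⟩ʳ p))
        ≡⟨ ∑-𝟙-< (τ ⟨$⟩ʳ p) ⟩
      toℕ (τ ⟨$⟩ʳ p) ∎

    inversions-remove : inversions τ + (smallerLeft + smallerLeft)
                      ≡ inversions (remove p τ) + (toℕ (τ ⟨$⟩ʳ p) + toℕ p)
    inversions-remove = begin
      inversions τ + (smallerLeft + smallerLeft)
        ≡⟨ cong (_+ (smallerLeft + smallerLeft)) inversions-split ⟩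
      inversionsWithRight + (inversionsWithLeft + inversionsAvoiding) + (smallerLeft + smallerLeft)
        ≡⟨ regroup inversionsWithRight inversionsWithLeft inversionsAvoiding smallerLeft ⟩
      inversionsAvoiding + ((inversionsWithRight + smallerLeft) + (inversionsWithLeft + smallerLeft))
        ≡⟨ cong₂ (λ x y → x + (y + (inversionsWithLeft + smallerLeft)))
             inversionsAvoiding≡inversions-remove inversionsWithRight+smallerLeft ⟩
      inversions (remove p τ) + (toℕ (τ ⟨$⟩ʳ p) + (inversionsWithLeft + smallerLeft))
        ≡⟨ cong (λ x → inversions (remove p τ) + (toℕ (τ ⟨$⟩ʳ p) + x))
             inversionsWithLeft+smallerLeft ⟩
      inversions (remove p τ) + (toℕ (τ ⟨$⟩ʳ p) + toℕ p) ∎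
      where
      regroup : ∀ r l a s → r + (l + a) + (s + s) ≡ a + ((r + s) + (l + s))
      regroup = solve-∀

  parity-inversions-remove : parity (inversions τ) ≡ parity (inversions (remove p τ)) ℙ.+ displacement τ p
  parity-inversions-remove = begin
    parity (inversions τ)
      ≡⟨ ℙ.+-identityʳ _ ⟨
    parity (inversions τ) ℙ.+ 0ℙ
      ≡⟨ cong (parity (inversions τ) ℙ.+_) (p+p≡0ℙ (parity smallerLeft)) ⟨
    parity (inversions τ) ℙ.+ (parity smallerLeft ℙ.+ parity smallerLeft)
      ≡⟨ cong (parity (inversions τ) ℙ.+_) (+-homo-+ smallerLeft smallerLeft) ⟨
    parity (inversions τ) ℙ.+ parity (smallerLeft + smallerLeft)
      ≡⟨ +-homo-+ (inversions τ) (smallerLeft + smallerLeft) ⟨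
    parity (inversions τ + (smallerLeft + smallerLeft))
      ≡⟨ cong parity inversions-remove ⟩
    parity (inversions (remove p τ) + (toℕ (τ ⟨$⟩ʳ p) + toℕ p))
      ≡⟨ +-homo-+ (inversions (remove p τ)) _ ⟩
    parity (inversions (remove p τ)) ℙ.+ parity (toℕ (τ ⟨$⟩ʳ p) + toℕ p)
      ≡⟨ cong (parity (inversions (remove p τ)) ℙ.+_) (+-homo-+ (toℕ (τ ⟨$⟩ʳ p)) (toℕ p)) ⟩
    parity (inversions (remove p τ)) ℙ.+ displacement τ p ∎

IsEven⇔parity≡0ℙ : (π : Permutation′ n) → IsEven π ⇔ (parity (inversions π) ≡ 0ℙ)
IsEven⇔parity≡0ℙ π = %2-≡⇔parity-≡ (inversions π) 0

par-≡⇔parity-≡ : (i j : Fin n) → (par i ≡ par j) ⇔ (parity (toℕ i) ≡ parity (toℕ j))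
par-≡⇔parity-≡ i j = ⇔-trans (%2-≡⇔parity-≡ (suc (toℕ i)) (suc (toℕ j))) (mk⇔
  (λ eq → trans (sym (suc-homo-⁻¹ (toℕ i))) (trans (cong _⁻¹ eq) (suc-homo-⁻¹ (toℕ j))))
  (λ eq → ⁻¹-injective (trans (suc-homo-⁻¹ (toℕ i)) (trans eq (sym (suc-homo-⁻¹ (toℕ j)))))))

module _ (τ : Permutation′ n) where

  InSOmega⇔displacement≡0ℙ : InSOmega τ ⇔ (∀ i → displacement τ i ≡ 0ℙ)
  InSOmega⇔displacement≡0ℙ = Π-cong-⇔ λ i →
    ⇔-trans (par-≡⇔parity-≡ (τ ⟨$⟩ʳ i) i) (⇔-sym (+≡0ℙ⇔≡ _ _))

  InX⇔displacement≡1ℙ : InX τ ⇔ (∀ i → displacement τ i ≡ 1ℙ)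
  InX⇔displacement≡1ℙ = Π-cong-⇔ λ i →
    ⇔-trans (¬-cong-⇔ (par-≡⇔parity-≡ (τ ⟨$⟩ʳ i) i)) (⇔-sym (+≡1ℙ⇔≢ _ _))

removals-even⇔parity-≡-displacement : (τ : Permutation′ (suc n)) →
  (∀ p → IsEven (remove p τ)) ⇔ (∀ p → parity (inversions τ) ≡ displacement τ p)
removals-even⇔parity-≡-displacement τ = Π-cong-⇔ λ p →
  ⇔-trans (IsEven⇔parity≡0ℙ (remove p τ)) (≡+⇒≡0ℙ⇔≡ (parity-inversions-remove τ p))

theorem4p4 : (n : ℕ) → 1 ≤ n → (τ : Permutation′ (suc n)) →
    Comp {n} (suc n) IsEven τ ⇔ ((InSOmega τ × IsEven τ) ⊎ (InX τ × ¬ IsEven τ))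
theorem4p4 n _ τ = begin
  Comp (suc n) IsEven τ
    ∼⟨ Comp-IsEven⇔removals-even τ ⟩
  (∀ p → IsEven (remove p τ))
    ∼⟨ removals-even⇔parity-≡-displacement τ ⟩
  (∀ p → parity (inversions τ) ≡ displacement τ p)
    ∼⟨ all-≡⇔constant (parity (inversions τ)) (displacement τ) ⟩
  (((∀ p → displacement τ p ≡ 0ℙ) × parity (inversions τ) ≡ 0ℙ)
    ⊎ ((∀ p → displacement τ p ≡ 1ℙ) × parity (inversions τ) ≢ 0ℙ))
    ∼⟨ ⇔-sym ((InSOmega⇔displacement≡0ℙ τ ×-⇔ IsEven⇔parity≡0ℙ τ)
               ⊎-⇔ (InX⇔displacement≡1ℙ τ ×-⇔ ¬-cong-⇔ (IsEven⇔parity≡0ℙ τ))) ⟩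
  ((InSOmega τ × IsEven τ) ⊎ (InX τ × ¬ IsEven τ)) ∎
  where open EquationalReasoning
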